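{- Let $\mathbb P=(P,\le,\Delta,f)$ be the syntactic forcing property over an at most countable transition-algebra signature $\Sigma$. For all $p\in P$ and all $\phi\in\mathrm{Sen}(\Delta_p)$, the following are equivalent: (1) $\Gamma_p\vdash_{\Delta_p}\phi$; (2) for every $q\ge p$ there exists $r\ge q$ with $\Gamma_r\vdash_{\Delta_r}\phi$.
   Context: Transition algebra (TA). A signature $\Sigma=(S,F\supseteq M,L)$ consists of sorts $S$, function symbols $F$, monotonic function symbols $M\subseteq F$ and transition labels $L$; it is at most countable if $S,F,L$ are. Actions: $\mathfrak a::=\lambda\mid\mathfrak a\mathbin{;}\mathfrak a\mid\mathfrak a\cup\mathfrak a\mid\mathfrak a^*$ ($\lambda\in L$); $\mathfrak a^n$ is the $n$-fold composition (for $n=0$, $t_1\stackrel{\mathfrak a^0}\Rightarrow t_2$ is read as $t_1=t_2$). $\Sigma$-sentences: $\phi::=t_1=t_2\mid t_1\stackrel{\mathfrak a}\Rightarrow t_2\mid\neg\phi\mid\bigvee\Phi\mid\exists X\,\phi'$ (ground terms, finite $\Phi$, finite variable set $X$ added as new constants giving $\Sigma[X]$, $\phi'\in\mathrm{Sen}(\Sigma[X])$); $\bot:=\bigvee\emptyset$. Atomic sentences: $t_1=t_2$, $t_1\stackrel{\lambda}\Rightarrow t_2$ ($\lambda\in L$), forming $\mathrm{Sen}_b(\Sigma)$. Dynamic entailment $\vdash$: the least family $\vdash_\Sigma\subseteq\mathcal P(\mathrm{Sen}(\Sigma))^2$ closed under Monotonicity ($\Gamma\supseteq\Phi\Rightarrow\Gamma\vdash\Phi$),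 Transitivity, Union, Translation along signature morphisms, and the rules: (R),(S),(T) for $=$; (F) congruence; (P) label transitions respect $=$; (M) monotonic symbols preserve label transitions in each argument; (Comp$_I$) from $t_1\stackrel{\mathfrak a_1}\Rightarrow t$, $t\stackrel{\mathfrak a_2}\Rightarrow t_2$ infer $t_1\stackrel{\mathfrak a_1;\mathfrak a_2}\Rightarrow t_2$; (Comp$_E$) if $\Gamma\vdash_\Sigma t_1\stackrel{\mathfrak a_1;\mathfrak a_2}\Rightarrow t_2$ and $\Gamma\cup\{t_1\stackrel{\mathfrak a_1}\Rightarrow x,x\stackrel{\mathfrak a_2}\Rightarrow t_2\}\vdash_{\Sigma[x]}\phi$ ($x$ new constant) then $\Gamma\vdash_\Sigma\phi$; (Union$_I$),(Union$_E$) introduction and case analysis for $\cup$; (Star$_I$) from $t_1\stackrel{\mathfrak a^n}\Rightarrow t_2$ infer $t_1\stackrel{\mathfrak a^*}\Rightarrow t_2$; (Star$_E$) if $\Gamma\vdash t_1\stackrel{\mathfrak a^*}\Rightarrow t_2$ and $\Gamma\cup\{t_1\stackrel{\mathfrak a^n}\Rightarrow t_2\}\vdash\phi$ for all $n\in\omega$ then $\Gamma\vdash\phi$; (Neg$_D$) from $\neg\neg\phi$ infer $\phi$; (False) from $\bot$ infer anything; (Neg$_I$) $\Gamma\cup\{\phi\}\vdash\bot$ gives $\Gamma\vdash\neg\phi$; (Neg$_E$) $\Gamma\vdash\neg\phi$ gives $\Gamma\cup\{\phi\}\vdash\bot$; (Disj$_I$),(Disj$_E$) introduction and case analysis for $\bigvee$;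 (Quant$_I$) $\Gamma\cup\{\phi\}\vdash_{\Sigma[X]}\gamma$ gives $\Gamma\cup\{\exists X\phi\}\vdash_\Sigma\gamma$; (Quant$_E$) the converse; (Subst) $\Gamma\vdash\theta(\phi)$ gives $\Gamma\vdash\exists X\phi$ for substitutions $\theta\colon X\to T_\Sigma$ (ground terms). Syntactic forcing property over $\Sigma$: fix an $S$-sorted set $C$ of new constants with each $C_s$ countably infinite. $P$ is the set of pairs $p=(\Delta_p,\Gamma_p)$ where $\Delta_p$ is $\Sigma$ plus a finite set $C_p\subseteq C$ of constants and $\Gamma_p\subseteq\mathrm{Sen}(\Delta_p)$ with $\Gamma_p\not\vdash_{\Delta_p}\bot$; $p\le q$ iff $\Delta_p\subseteq\Delta_q$ and $\Gamma_p\subseteq\Gamma_q$; $\Delta(p)=\Delta_p$; $f(p)=\Gamma_p\cap\mathrm{Sen}_b(\Delta_p)$. -}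

module Defs where

open import Level using (0ℓ) renaming (suc to lsuc)
open import Data.Nat using (ℕ)
open import Data.Fin using (Fin; zero; suc)
open import Data.Empty using (⊥)
open import Data.Sum using (_⊎_; inj₁; inj₂)
open import Data.Product using (Σ; Σ-syntax; _×_; _,_; proj₁; proj₂)
open import Data.List using (List; []; _∷_; map; length; lookup)
open import Data.List.Properties using (map-id)
open import Data.List.Membership.Propositional using (_∈_)
open import Data.List.Membership.Propositional.Properties using (∈-map⁺)
open import Data.List.Relation.Unary.Any using (here)
open import Data.List.Relation.Unary.Unique.Propositional using (Unique)
open import Relation.Nullary using (¬_)
open import Relation.Binary.PropositionalEquality using (_≡_; refl; subst; sym; trans; cong)
open import Function.Definitions using (Injective)

record Sig : Set₁ where
  field
    S : Set
    F : List S → S → Set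
    M : ∀ {w s} → F w s → Set           -- the subset M ⊆ F of monotonic symbols
    L : Set
open Sig public

Countable : Set → Set
Countable A = Σ (A → ℕ) λ g → Injective _≡_ _≡_ g

record AtMostCountable (Sg : Sig) : Set where
  field
    sorts  : Countable (S Sg)
    funs   : Countable (Σ[ w ∈ List (S Sg) ] Σ[ s ∈ S Sg ] F Sg w s)
    labels : Countable (L Sg)

mutual
  data Term (Sg : Sig) : S Sg → Set where
    app : ∀ {w s} → F Sg w s → Terms Sg w → Term Sg s

  data Terms (Sg : Sig) : List (S Sg) → Set where
    []  : Terms Sg []
    _∷_ : ∀ {s w} → Term Sg s → Terms Sg w → Terms Sg (s ∷ w)

argAt : ∀ {Sg w} → Terms Sg w → (i : Fin (length w)) → Term Sg (lookup w i)
argAt (t ∷ ts) zero    = t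
argAt (t ∷ ts) (suc i) = argAt ts i

setArg : ∀ {Sg w} → Terms Sg w → (i : Fin (length w)) → Term Sg (lookup w i) → Terms Sg w
setArg (t ∷ ts) zero    u = u ∷ ts
setArg (t ∷ ts) (suc i) u = t ∷ setArg ts i u

data Act (Sg : Sig) : Set where
  ⟨_⟩  : L Sg → Act Sg
  _⨾_  : Act Sg → Act Sg → Act Sg
  _∪ₐ_ : Act Sg → Act Sg → Act Sg
  _⋆   : Act Sg → Act Sg

-- a ^ (suc n) : (n+1)-fold composition a ; (a ; ( … ; a))
pow : ∀ {Sg} → Act Sg → ℕ → Act Sg
pow a ℕ.zero    = a
pow a (ℕ.suc n) = a ⨾ pow a n

-- Extension of a signature by new constants:  Sg ⊕ K  (K an S-sorted set)

MonoExt : (Sg : Sig) (K : S Sg → Set) → ∀ {w s} → F Sg w s ⊎ (w ≡ [] × K s) → Set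
MonoExt Sg K (inj₁ σ) = M Sg σ
MonoExt Sg K (inj₂ _) = ⊥

_⊕_ : (Sg : Sig) → (S Sg → Set) → Sig
Sg ⊕ K = record
  { S = S Sg
  ; F = λ w s → F Sg w s ⊎ (w ≡ [] × K s)
  ; M = MonoExt Sg K
  ; L = L Sg }

-- Σ[X] for a finite set X of variables (given by their sorts)
_[_] : (Sg : Sig) → List (S Sg) → Sig
Sg [ X ] = Sg ⊕ (λ s → s ∈ X)

data Sen : Sig → Set₁ where
  _≐_   : ∀ {Sg s} → Term Sg s → Term Sg s → Sen Sg
  _⟶[_]_ : ∀ {Sg s} → Term Sg s → Act Sg → Term Sg s → Sen Sg
  ¬ₛ_   : ∀ {Sg} → Sen Sg → Sen Sg
  ⋁     : ∀ {Sg} → List (Sen Sg) → Sen Sg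
  ∃ₛ    : ∀ {Sg} (X : List (S Sg)) → Sen (Sg [ X ]) → Sen Sg

⊥ₛ : ∀ {Sg} → Sen Sg
⊥ₛ = ⋁ []

-- t₁ =(a^n)=> t₂, where n = 0 reads t₁ = t₂
powSen : ∀ {Sg s} → Term Sg s → Act Sg → ℕ → Term Sg s → Sen Sg
powSen t₁ a ℕ.zero    t₂ = t₁ ≐ t₂
powSen t₁ a (ℕ.suc n) t₂ = t₁ ⟶[ pow a n ] t₂

-- Generalised morphisms (symbols may go to symbols, constants may go
-- to ground terms); used for signature morphisms and substitutions.

record GMor (Sg₁ Sg₂ : Sig) : Set where
  field
    srt : S Sg₁ → S Sg₂
    op  : ∀ {w s} → F Sg₁ w s → F Sg₂ (map srt w) (srt s) ⊎ (w ≡ [] × Term Sg₂ (srt s))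
    lab : L Sg₁ → L Sg₂
open GMor public

module _ {Sg₁ Sg₂ : Sig} (h : GMor Sg₁ Sg₂) where
  mutual
    gT : ∀ {s} → Term Sg₁ s → Term Sg₂ (srt h s)
    gT (app σ ts) with op h σ
    ... | inj₁ σ'         = app σ' (gTs ts)
    ... | inj₂ (refl , t) = t

    gTs : ∀ {w} → Terms Sg₁ w → Terms Sg₂ (map (srt h) w)
    gTs []       = []
    gTs (t ∷ ts) = gT t ∷ gTs ts

  gA : Act Sg₁ → Act Sg₂
  gA ⟨ l ⟩     = ⟨ lab h l ⟩
  gA (a ⨾ b)   = gA a ⨾ gA b
  gA (a ∪ₐ b)  = gA a ∪ₐ gA b
  gA (a ⋆)     = gA a ⋆

idArity : ∀ {Sg : Sig} {w s} → F Sg w s → F Sg (map (λ x → x) w) s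
idArity {Sg} {w} {s} σ = subst (λ v → F Sg v s) (sym (map-id w)) σ

inclG : (Sg : Sig) (K : S Sg → Set) → GMor Sg (Sg ⊕ K)
inclG Sg K = record { srt = λ x → x ; op = λ σ → inj₁ (inj₁ (idArity {Sg} σ)) ; lab = λ l → l }

ext : ∀ {Sg₁ Sg₂} (h : GMor Sg₁ Sg₂) (X : List (S Sg₁)) →
      GMor (Sg₁ [ X ]) (Sg₂ [ map (srt h) X ])
ext {Sg₁} {Sg₂} h X = record { srt = srt h ; op = op' ; lab = lab h }
  where
  op' : ∀ {w s} → F (Sg₁ [ X ]) w s →
        F (Sg₂ [ map (srt h) X ]) (map (srt h) w) (srt h s) ⊎ (w ≡ [] × Term (Sg₂ [ map (srt h) X ]) (srt h s))
  op' (inj₁ σ) with op h σ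
  ... | inj₁ σ'     = inj₁ (inj₁ σ')
  ... | inj₂ (e , t) = inj₂ (e , gT (inclG Sg₂ (λ s → s ∈ map (srt h) X)) t)
  op' (inj₂ (e , i)) = inj₁ (inj₂ (cong (map (srt h)) e , ∈-map⁺ (srt h) i))

gS : ∀ {Sg₁ Sg₂} → GMor Sg₁ Sg₂ → Sen Sg₁ → Sen Sg₂
gSs : ∀ {Sg₁ Sg₂} → GMor Sg₁ Sg₂ → List (Sen Sg₁) → List (Sen Sg₂)
gS h (t₁ ≐ t₂)      = gT h t₁ ≐ gT h t₂
gS h (t₁ ⟶[ a ] t₂) = gT h t₁ ⟶[ gA h a ] gT h t₂
gS h (¬ₛ φ)         = ¬ₛ gS h φ
gS h (⋁ Φ)          = ⋁ (gSs h Φ)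
gS h (∃ₛ X φ)       = ∃ₛ (map (srt h) X) (gS (ext h X) φ)
gSs h []       = []
gSs h (φ ∷ Φ)  = gS h φ ∷ gSs h Φ

record Mor (Sg₁ Sg₂ : Sig) : Set where
  field
    srt  : S Sg₁ → S Sg₂
    op   : ∀ {w s} → F Sg₁ w s → F Sg₂ (map srt w) (srt s)
    mono : ∀ {w s} (σ : F Sg₁ w s) → M Sg₁ σ → M Sg₂ (op σ)
    lab  : L Sg₁ → L Sg₂

toG : ∀ {Sg₁ Sg₂} → Mor Sg₁ Sg₂ → GMor Sg₁ Sg₂
toG χ = record { srt = Mor.srt χ ; op = λ σ → inj₁ (Mor.op χ σ) ; lab = Mor.lab χ }

tr : ∀ {Sg₁ Sg₂} → Mor Sg₁ Sg₂ → Sen Sg₁ → Sen Sg₂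
tr χ = gS (toG χ)

monoSubst : ∀ {Sg : Sig} {w w' s} (e : w ≡ w') (σ : F Sg w s) →
            M Sg σ → M Sg (subst (λ v → F Sg v s) e σ)
monoSubst refl σ m = m

ι : (Sg : Sig) (K : S Sg → Set) → Mor Sg (Sg ⊕ K)
ι Sg K = record
  { srt = λ x → x
  ; op = λ σ → inj₁ (idArity {Sg} σ)
  ; mono = λ {w} σ m → monoSubst {Sg} (sym (map-id w)) σ m
  ; lab = λ l → l }

ιext : (Sg : Sig) {K K' : S Sg → Set} → (∀ {s} → K s → K' s) → Mor (Sg ⊕ K) (Sg ⊕ K')
ιext Sg {K} {K'} sub = record { srt = λ x → x ; op = op' ; mono = mono' ; lab = λ l → l }
  where
  op' : ∀ {w s} → F (Sg ⊕ K) w s → F (Sg ⊕ K') (map (λ x → x) w) s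
  op' (inj₁ σ)       = inj₁ (idArity {Sg} σ)
  op' (inj₂ (e , k)) = inj₂ (trans (map-id _) e , sub k)
  mono' : ∀ {w s} (σ : F (Sg ⊕ K) w s) → M (Sg ⊕ K) σ → M (Sg ⊕ K') (op' σ)
  mono' {w} (inj₁ σ) m = monoSubst {Sg} (sym (map-id w)) σ m

substG : (Sg : Sig) (X : List (S Sg)) → (∀ {s} → s ∈ X → Term Sg s) → GMor (Sg [ X ]) Sg
substG Sg X θ = record { srt = λ x → x ; op = op' ; lab = λ l → l }
  where
  op' : ∀ {w s} → F (Sg [ X ]) w s → F Sg (map (λ x → x) w) s ⊎ (w ≡ [] × Term Sg s)
  op' (inj₁ σ)       = inj₁ (idArity {Sg} σ)
  op' (inj₂ (e , i)) = inj₂ (e , θ i)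

SenSet : Sig → Set₂
SenSet Sg = Sen Sg → Set₁

_∪｛_｝ : ∀ {Sg} → SenSet Sg → Sen Sg → SenSet Sg
(Γ ∪｛ φ ｝) ψ = Γ ψ ⊎ (ψ ≡ φ)

img : ∀ {Sg₁ Sg₂} → GMor Sg₁ Sg₂ → SenSet Sg₁ → SenSet Sg₂
img h Γ ψ = Σ[ γ ∈ Sen _ ] (Γ γ × gS h γ ≡ ψ)

wk : ∀ {Sg} (K : S Sg → Set) → Sen Sg → Sen (Sg ⊕ K)
wk K = tr (ι _ K)

wkSet : ∀ {Sg} (K : S Sg → Set) → SenSet Sg → SenSet (Sg ⊕ K)
wkSet K = img (toG (ι _ K))

wkT : ∀ {Sg} (K : S Sg → Set) {s} → Term Sg s → Term (Sg ⊕ K) s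
wkT K = gT (toG (ι _ K))

wkA : ∀ {Sg} (K : S Sg → Set) → Act Sg → Act (Sg ⊕ K)
wkA K = gA (toG (ι _ K))

newConst : ∀ {Sg} (s : S Sg) → Term (Sg [ s ∷ [] ]) s
newConst s = app (inj₂ (refl , here refl)) []

data _⊢[_]_ : {Sg : Sig} → SenSet Sg → (Sg' : Sig) → Sen Sg' → Set₂

_⊢ₛ_ : ∀ {Sg} → SenSet Sg → SenSet Sg → Set₂
_⊢ₛ_ {Sg} Γ Φ = ∀ φ → Φ φ → Γ ⊢[ Sg ] φ

data _⊢[_]_ where
  monotonicity : ∀ {Sg} {Γ : SenSet Sg} {φ} → Γ φ → Γ ⊢[ Sg ] φ
  transitivity : ∀ {Sg} {Γ Φ : SenSet Sg} {φ} → Γ ⊢ₛ Φ → Φ ⊢[ Sg ] φ → Γ ⊢[ Sg ] φ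
  translation  : ∀ {Sg Sg'} {Γ : SenSet Sg} {φ} (χ : Mor Sg Sg') →
                 Γ ⊢[ Sg ] φ → img (toG χ) Γ ⊢[ Sg' ] tr χ φ
  R : ∀ {Sg} {Γ : SenSet Sg} {s} (t : Term Sg s) → Γ ⊢[ Sg ] (t ≐ t)
  S′ : ∀ {Sg} {Γ : SenSet Sg} {s} {t₁ t₂ : Term Sg s} →
       Γ ⊢[ Sg ] (t₁ ≐ t₂) → Γ ⊢[ Sg ] (t₂ ≐ t₁)
  T : ∀ {Sg} {Γ : SenSet Sg} {s} {t₁ t₂ t₃ : Term Sg s} →
      Γ ⊢[ Sg ] (t₁ ≐ t₂) → Γ ⊢[ Sg ] (t₂ ≐ t₃) → Γ ⊢[ Sg ] (t₁ ≐ t₃)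
  Fc : ∀ {Sg} {Γ : SenSet Sg} {w s} (σ : F Sg w s) (ts ts' : Terms Sg w) →
       (∀ i → Γ ⊢[ Sg ] (argAt ts i ≐ argAt ts' i)) → Γ ⊢[ Sg ] (app σ ts ≐ app σ ts')
  P′ : ∀ {Sg} {Γ : SenSet Sg} {s} {t₁ t₁' t₂ t₂' : Term Sg s} {λ' : L Sg} →
       Γ ⊢[ Sg ] (t₁ ≐ t₁') → Γ ⊢[ Sg ] (t₁ ⟶[ ⟨ λ' ⟩ ] t₂) → Γ ⊢[ Sg ] (t₂ ≐ t₂') →
       Γ ⊢[ Sg ] (t₁' ⟶[ ⟨ λ' ⟩ ] t₂')
  Mo : ∀ {Sg} {Γ : SenSet Sg} {w s} (σ : F Sg w s) → M Sg σ → (ts : Terms Sg w)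
       (i : Fin (length w)) (t' : Term Sg (lookup w i)) {λ' : L Sg} →
       Γ ⊢[ Sg ] (argAt ts i ⟶[ ⟨ λ' ⟩ ] t') →
       Γ ⊢[ Sg ] (app σ ts ⟶[ ⟨ λ' ⟩ ] app σ (setArg ts i t'))
  CompI : ∀ {Sg} {Γ : SenSet Sg} {s} {t₁ t t₂ : Term Sg s} {a₁ a₂} →
          Γ ⊢[ Sg ] (t₁ ⟶[ a₁ ] t) → Γ ⊢[ Sg ] (t ⟶[ a₂ ] t₂) → Γ ⊢[ Sg ] (t₁ ⟶[ a₁ ⨾ a₂ ] t₂)
  CompE : ∀ {Sg} {Γ : SenSet Sg} {s} {t₁ t₂ : Term Sg s} {a₁ a₂} {φ} →
          Γ ⊢[ Sg ] (t₁ ⟶[ a₁ ⨾ a₂ ] t₂) →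
          ((wkSet (λ s' → s' ∈ s ∷ []) Γ
              ∪｛ wkT (λ s' → s' ∈ s ∷ []) t₁ ⟶[ wkA (λ s' → s' ∈ s ∷ []) a₁ ] newConst s ｝)
              ∪｛ newConst s ⟶[ wkA (λ s' → s' ∈ s ∷ []) a₂ ] wkT (λ s' → s' ∈ s ∷ []) t₂ ｝)
            ⊢[ Sg [ s ∷ [] ] ] wk (λ s' → s' ∈ s ∷ []) φ →
          Γ ⊢[ Sg ] φ
  UnionI₁ : ∀ {Sg} {Γ : SenSet Sg} {s} {t₁ t₂ : Term Sg s} {a₁} a₂ →
            Γ ⊢[ Sg ] (t₁ ⟶[ a₁ ] t₂) → Γ ⊢[ Sg ] (t₁ ⟶[ a₁ ∪ₐ a₂ ] t₂)
  UnionI₂ : ∀ {Sg} {Γ : SenSet Sg} {s} {t₁ t₂ : Term Sg s} a₁ {a₂} →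
            Γ ⊢[ Sg ] (t₁ ⟶[ a₂ ] t₂) → Γ ⊢[ Sg ] (t₁ ⟶[ a₁ ∪ₐ a₂ ] t₂)
  UnionE : ∀ {Sg} {Γ : SenSet Sg} {s} {t₁ t₂ : Term Sg s} {a₁ a₂} {φ} →
           Γ ⊢[ Sg ] (t₁ ⟶[ a₁ ∪ₐ a₂ ] t₂) →
           (Γ ∪｛ t₁ ⟶[ a₁ ] t₂ ｝) ⊢[ Sg ] φ → (Γ ∪｛ t₁ ⟶[ a₂ ] t₂ ｝) ⊢[ Sg ] φ →
           Γ ⊢[ Sg ] φ
  StarI : ∀ {Sg} {Γ : SenSet Sg} {s} {t₁ t₂ : Term Sg s} {a} (n : ℕ) →
          Γ ⊢[ Sg ] powSen t₁ a n t₂ → Γ ⊢[ Sg ] (t₁ ⟶[ a ⋆ ] t₂)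
  StarE : ∀ {Sg} {Γ : SenSet Sg} {s} {t₁ t₂ : Term Sg s} {a} {φ} →
          Γ ⊢[ Sg ] (t₁ ⟶[ a ⋆ ] t₂) →
          (∀ (n : ℕ) → (Γ ∪｛ powSen t₁ a n t₂ ｝) ⊢[ Sg ] φ) → Γ ⊢[ Sg ] φ
  NegD  : ∀ {Sg} {Γ : SenSet Sg} {φ} → Γ ⊢[ Sg ] (¬ₛ ¬ₛ φ) → Γ ⊢[ Sg ] φ
  False : ∀ {Sg} {Γ : SenSet Sg} {φ} → Γ ⊢[ Sg ] ⊥ₛ → Γ ⊢[ Sg ] φ
  NegI  : ∀ {Sg} {Γ : SenSet Sg} {φ} → (Γ ∪｛ φ ｝) ⊢[ Sg ] ⊥ₛ → Γ ⊢[ Sg ] (¬ₛ φ)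
  NegE  : ∀ {Sg} {Γ : SenSet Sg} {φ} → Γ ⊢[ Sg ] (¬ₛ φ) → (Γ ∪｛ φ ｝) ⊢[ Sg ] ⊥ₛ
  DisjI : ∀ {Sg} {Γ : SenSet Sg} {Φ : List (Sen Sg)} {φ} →
          φ ∈ Φ → Γ ⊢[ Sg ] φ → Γ ⊢[ Sg ] ⋁ Φ
  DisjE : ∀ {Sg} {Γ : SenSet Sg} {Φ : List (Sen Sg)} {ψ} →
          Γ ⊢[ Sg ] ⋁ Φ → (∀ φ → φ ∈ Φ → (Γ ∪｛ φ ｝) ⊢[ Sg ] ψ) → Γ ⊢[ Sg ] ψ
  QuantI : ∀ {Sg} {Γ : SenSet Sg} {X : List (S Sg)} {φ : Sen (Sg [ X ])} {γ} →
           (wkSet (λ s → s ∈ X) Γ ∪｛ φ ｝) ⊢[ Sg [ X ] ] wk (λ s → s ∈ X) γ →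
           (Γ ∪｛ ∃ₛ X φ ｝) ⊢[ Sg ] γ
  QuantE : ∀ {Sg} {Γ : SenSet Sg} {X : List (S Sg)} {φ : Sen (Sg [ X ])} {γ} →
           (Γ ∪｛ ∃ₛ X φ ｝) ⊢[ Sg ] γ →
           (wkSet (λ s → s ∈ X) Γ ∪｛ φ ｝) ⊢[ Sg [ X ] ] wk (λ s → s ∈ X) γ
  Subst : ∀ {Sg} {Γ : SenSet Sg} {X : List (S Sg)} {φ : Sen (Sg [ X ])}
          (θ : ∀ {s} → s ∈ X → Term Sg s) →
          Γ ⊢[ Sg ] gS (substG Sg X θ) φ → Γ ⊢[ Sg ] ∃ₛ X φ

-- The syntactic forcing property over Σ.
-- C_s = ℕ for every sort s, i.e. C = S × ℕ (tagged by sort).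

module Forcing (Sg : Sig) where

  -- Δ for a finite set C' ⊆ C of constants (given as a duplicate-free list)
  Consts : List (S Sg × ℕ) → S Sg → Set
  Consts C' s = Σ[ n ∈ ℕ ] ((s , n) ∈ C')

  Δ[_] : List (S Sg × ℕ) → Sig
  Δ[ C' ] = Sg ⊕ Consts C'

  record Cond : Set₂ where
    field
      Cp   : List (S Sg × ℕ)
      uniq : Unique Cp
      Γp   : SenSet Δ[ Cp ]
      cons : ¬ (Γp ⊢[ Δ[ Cp ] ] ⊥ₛ)
  open Cond public

  Δ : Cond → Sig
  Δ p = Δ[ Cp p ]

  _⊆C_ : List (S Sg × ℕ) → List (S Sg × ℕ) → Set
  A ⊆C B = ∀ {c} → c ∈ A → c ∈ B

  inclC : ∀ {A B} → A ⊆C B → Mor Δ[ A ] Δ[ B ]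
  inclC sub = ιext Sg (λ { (n , m) → (n , sub m) })

  record _≤_ (p q : Cond) : Set₁ where
    field
      Δ⊆ : Cp p ⊆C Cp q
      Γ⊆ : ∀ φ → Γp p φ → Γp q (tr (inclC Δ⊆) φ)
  open _≤_ public

  lift : ∀ {p q r} → p ≤ q → q ≤ r → Sen (Δ p) → Sen (Δ r)
  lift pq qr = tr (inclC (λ m → Δ⊆ qr (Δ⊆ pq m)))

-- (1) ⇒ (2): take r = q; a derivation from Γ_p is carried to Γ_q by the Translation rule
-- along Δ_p ⊆ Δ_q. (2) ⇒ (1) is classical: if Γ_p ⊬ φ then Γ_p ∪ {¬φ} is consistent, hence a
-- condition q ≥ p, and an r ≥ q deriving φ also contains ¬φ, contradicting its consistency.
-- The only technical point is reflexivity of ≤, i.e. that translation along the identity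
-- inclusion Δ_p ⊆ Δ_p fixes every sentence; this goes by induction on sentences.
module Submission where

open import Defs
open import Level using (0ℓ) renaming (suc to lsuc)
open import Data.Product using (Σ-syntax; _×_; _,_)
open import Data.Sum using (_⊎_; inj₁; inj₂)
open import Data.Empty using (⊥-elim)
open import Data.List using (List; []; _∷_; map)
open import Data.List.Properties using (map-id)
open import Data.List.Membership.Propositional using (_∈_)
open import Data.List.Membership.Propositional.Properties using (∈-map⁺)
open import Data.List.Relation.Unary.Any using (here; there)
open import Function using (id)
open import Function.Bundles using (_⇔_; mk⇔)
open import Axiom.ExcludedMiddle using (ExcludedMiddle)
open import Relation.Nullary using (¬_; yes; no)
open import Relation.Binary.PropositionalEquality
  using (_≡_; refl; subst; sym; trans; cong; cong₂)

subst-inj₁ : ∀ {A : Set} (P Q : A → Set) {x y : A} (e : x ≡ y) (p : P x) →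
             subst (λ v → P v ⊎ Q v) e (inj₁ p) ≡ inj₁ (subst P e p)
subst-inj₁ P Q refl p = refl

app-subst : ∀ {Sg : Sig} {w w′ s} (e : w′ ≡ w) (σ : F Sg w s) (ts : Terms Sg w′) →
            app (subst (λ v → F Sg v s) (sym e) σ) ts ≡ app σ (subst (Terms Sg) e ts)
app-subst refl σ ts = refl

subst-∷ : ∀ {Sg : Sig} {s w w′} (e : w′ ≡ w) (t : Term Sg s) (ts : Terms Sg w′) →
          subst (Terms Sg) (cong (s ∷_) e) (t ∷ ts) ≡ t ∷ subst (Terms Sg) e ts
subst-∷ refl t ts = refl

∈-map⁺-id : ∀ {A : Set} {x : A} (xs : List A) (x∈xs : x ∈ xs) →
            ∈-map⁺ id x∈xs ≡ subst (x ∈_) (sym (map-id xs)) x∈xs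
∈-map⁺-id (y ∷ ys) (here refl) = here-subst (map-id ys)
  where
  here-subst : ∀ {zs} (e : zs ≡ ys) →
               here refl ≡ subst (y ∈_) (sym (cong (y ∷_) e)) (here refl)
  here-subst refl = refl
∈-map⁺-id {x = x} (y ∷ ys) (there x∈ys) =
  trans (cong there (∈-map⁺-id ys x∈ys)) (there-subst (map-id ys) x∈ys)
  where
  there-subst : ∀ {zs} (e : zs ≡ ys) (x∈ys : x ∈ ys) →
                there (subst (x ∈_) (sym e) x∈ys) ≡ subst (x ∈_) (sym (cong (y ∷_) e)) (there x∈ys)
  there-subst refl x∈ys = refl

∃ₛ-subst : ∀ {Sg : Sig} {X X′ : List (S Sg)} (e : X′ ≡ X) (φ : Sen (Sg [ X ])) →
           ∃ₛ X′ (subst Sen (cong (Sg [_]) (sym e)) φ) ≡ ∃ₛ X φ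
∃ₛ-subst refl φ = refl

record IdentityMorphism (Sg : Sig) : Set where
  field
    symbol    : ∀ {w s} → F Sg w s → F Sg (map id w) s ⊎ (w ≡ [] × Term Sg s)
    label     : L Sg → L Sg
    symbol-id : ∀ {w s} (σ : F Sg w s) → symbol σ ≡ inj₁ (idArity {Sg} σ)
    label-id  : ∀ l → label l ≡ l

  morphism : GMor Sg Sg
  morphism = record { srt = id ; op = symbol ; lab = label }

  mutual
    gT-id : ∀ {s} (t : Term Sg s) → gT morphism t ≡ t
    gT-id (app {w} σ ts) rewrite symbol-id σ =
      trans (app-subst (map-id w) σ (gTs morphism ts)) (cong (app σ) (gTs-id ts))

    gTs-id : ∀ {w} (ts : Terms Sg w) → subst (Terms Sg) (map-id w) (gTs morphism ts) ≡ ts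
    gTs-id [] = refl
    gTs-id {s ∷ w} (t ∷ ts) =
      trans (subst-∷ (map-id w) (gT morphism t) (gTs morphism ts))
            (cong₂ _∷_ (gT-id t) (gTs-id ts))

  gA-id : (a : Act Sg) → gA morphism a ≡ a
  gA-id ⟨ l ⟩    = cong ⟨_⟩ (label-id l)
  gA-id (a ⨾ b)  = cong₂ _⨾_ (gA-id a) (gA-id b)
  gA-id (a ∪ₐ b) = cong₂ _∪ₐ_ (gA-id a) (gA-id b)
  gA-id (a ⋆)    = cong _⋆ (gA-id a)

-- Extending an identity morphism to variables X lands in Sg [ map id X ], which is only
-- propositionally Sg [ X ]; hence identities have to be considered along an equation of signatures.
IsIdentityAlong : ∀ {Sg₁ Sg₂ : Sig} → Sg₁ ≡ Sg₂ → GMor Sg₁ Sg₂ → Set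
IsIdentityAlong {Sg} refl h = Σ[ i ∈ IdentityMorphism Sg ] h ≡ IdentityMorphism.morphism i

rename-isIdentityAlong : ∀ {Sg : Sig} {X X′ : List (S Sg)} (e : X′ ≡ X)
  (op′ : ∀ {w s} → F (Sg [ X ]) w s → F (Sg [ X′ ]) (map id w) s ⊎ (w ≡ [] × Term (Sg [ X′ ]) s))
  {lab′ : L Sg → L Sg} → (∀ l → lab′ l ≡ l) →
  (∀ {w s} (σ : F Sg w s) → op′ (inj₁ σ) ≡ inj₁ (inj₁ (idArity {Sg} σ))) →
  (∀ {w s} (w≡[] : w ≡ []) (s∈X : s ∈ X) →
     op′ (inj₂ (w≡[] , s∈X)) ≡ inj₁ (inj₂ (cong (map id) w≡[] , subst (s ∈_) (sym e) s∈X))) →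
  IsIdentityAlong (cong (Sg [_]) (sym e)) (record { srt = id ; op = op′ ; lab = lab′ })
rename-isIdentityAlong {Sg} {X} refl op′ lab-id inj₁-id inj₂-id =
  record { symbol = op′ ; label = _ ; symbol-id = op′-id ; label-id = lab-id } , refl
  where
  op′-id : ∀ {w s} (σ : F (Sg [ X ]) w s) → op′ σ ≡ inj₁ (idArity {Sg [ X ]} σ)
  op′-id {w} {s} (inj₁ σ) =
    trans (inj₁-id σ) (cong inj₁ (sym (subst-inj₁ (λ v → F Sg v s) (λ v → v ≡ [] × s ∈ X) _ σ)))
  op′-id (inj₂ (refl , s∈X)) = inj₂-id refl s∈X

ext-isIdentityAlong : ∀ {Sg : Sig} (i : IdentityMorphism Sg) (X : List (S Sg)) →
  IsIdentityAlong (cong (Sg [_]) (sym (map-id X))) (ext (IdentityMorphism.morphism i) X)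
ext-isIdentityAlong {Sg} i X =
  rename-isIdentityAlong (map-id X) (GMor.op (ext morphism X)) label-id inj₁-id inj₂-id
  where
  open IdentityMorphism i

  inj₁-id : ∀ {w s} (σ : F Sg w s) → GMor.op (ext morphism X) (inj₁ σ) ≡ inj₁ (inj₁ (idArity {Sg} σ))
  inj₁-id σ rewrite symbol-id σ = refl

  inj₂-id : ∀ {w s} (w≡[] : w ≡ []) (s∈X : s ∈ X) →
            GMor.op (ext morphism X) (inj₂ (w≡[] , s∈X))
              ≡ inj₁ (inj₂ (cong (map id) w≡[] , subst (s ∈_) (sym (map-id X)) s∈X))
  inj₂-id w≡[] s∈X = cong (λ j → inj₁ (inj₂ (cong (map id) w≡[] , j))) (∈-map⁺-id X s∈X)

mutual
  gS-identityAlong : ∀ {Sg₁ Sg₂ : Sig} (e : Sg₁ ≡ Sg₂) (h : GMor Sg₁ Sg₂) → IsIdentityAlong e h →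
                     (ψ : Sen Sg₁) → gS h ψ ≡ subst Sen e ψ
  gS-identityAlong refl _ (i , refl) = gS-id i

  gS-id : ∀ {Sg : Sig} (i : IdentityMorphism Sg) (ψ : Sen Sg) →
          gS (IdentityMorphism.morphism i) ψ ≡ ψ
  gS-id i (t₁ ≐ t₂)      = cong₂ _≐_ (gT-id t₁) (gT-id t₂)
    where open IdentityMorphism i
  gS-id i (t₁ ⟶[ a ] t₂) =
    trans (cong₂ (λ u b → u ⟶[ b ] gT morphism t₂) (gT-id t₁) (gA-id a))
          (cong (t₁ ⟶[ a ]_) (gT-id t₂))
    where open IdentityMorphism i
  gS-id i (¬ₛ ψ)         = cong ¬ₛ_ (gS-id i ψ)
  gS-id i (⋁ Φ)          = cong ⋁ (gSs-id i Φ)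
  gS-id i (∃ₛ X φ)       =
    trans (cong (∃ₛ (map id X)) (gS-identityAlong _ _ (ext-isIdentityAlong i X) φ))
          (∃ₛ-subst (map-id X) φ)

  gSs-id : ∀ {Sg : Sig} (i : IdentityMorphism Sg) (Φ : List (Sen Sg)) →
           gSs (IdentityMorphism.morphism i) Φ ≡ Φ
  gSs-id i []      = refl
  gSs-id i (ψ ∷ Φ) = cong₂ _∷_ (gS-id i ψ) (gSs-id i Φ)

cut : ∀ {Sg : Sig} {Γ : SenSet Sg} {φ ψ} →
      Γ ⊢[ Sg ] φ → (Γ ∪｛ φ ｝) ⊢[ Sg ] ψ → Γ ⊢[ Sg ] ψ
cut {Γ = Γ} {φ} ⊢φ = transitivity {Φ = Γ ∪｛ φ ｝} ⊢Γ∪φ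
  where
  ⊢Γ∪φ : Γ ⊢ₛ (Γ ∪｛ φ ｝)
  ⊢Γ∪φ _ (inj₁ γ)    = monotonicity γ
  ⊢Γ∪φ _ (inj₂ refl) = ⊢φ

⊥-intro : ∀ {Sg : Sig} {Γ : SenSet Sg} {φ} → Γ ⊢[ Sg ] φ → Γ ⊢[ Sg ] (¬ₛ φ) → Γ ⊢[ Sg ] ⊥ₛ
⊥-intro ⊢φ ⊢¬φ = cut ⊢φ (NegE ⊢¬φ)

∪¬-consistent : ∀ {Sg : Sig} {Γ : SenSet Sg} {φ} →
                ¬ (Γ ⊢[ Sg ] φ) → ¬ ((Γ ∪｛ ¬ₛ φ ｝) ⊢[ Sg ] ⊥ₛ)
∪¬-consistent ⊬φ ⊢⊥ = ⊬φ (NegD (NegI ⊢⊥))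

module _ (Sg : Sig) where
  open Forcing Sg

  tr-inclC-id : ∀ {C} (ψ : Sen Δ[ C ]) → tr (inclC {C} {C} (λ c∈C → c∈C)) ψ ≡ ψ
  tr-inclC-id {C} = gS-id (record
    { symbol = _ ; label = id ; symbol-id = symbol-id ; label-id = λ _ → refl })
    where
    symbol-id : ∀ {w s} (σ : F Δ[ C ] w s) →
                GMor.op (toG (inclC {C} {C} (λ c∈C → c∈C))) σ ≡ inj₁ (idArity {Δ[ C ]} σ)
    symbol-id {w} {s} (inj₁ σ) =
      cong inj₁ (sym (subst-inj₁ (λ v → F Sg v s) (λ v → v ≡ [] × Consts C s) _ σ))
    symbol-id (inj₂ (refl , _)) = refl

  ⊆⇒Γ⊆ : ∀ {C} {Γ Γ′ : SenSet Δ[ C ]} → (∀ φ → Γ φ → Γ′ φ) →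
         ∀ φ → Γ φ → Γ′ (tr (inclC {C} {C} (λ c∈C → c∈C)) φ)
  ⊆⇒Γ⊆ {Γ′ = Γ′} Γ⊆Γ′ φ φ∈Γ = subst Γ′ (sym (tr-inclC-id φ)) (Γ⊆Γ′ φ φ∈Γ)

  ≤-refl : (p : Cond) → p ≤ p
  ≤-refl p = record { Δ⊆ = λ c∈C → c∈C ; Γ⊆ = ⊆⇒Γ⊆ (λ _ φ∈Γ → φ∈Γ) }

  ≤-preserves-⊢ : ∀ {p q} (p≤q : p ≤ q) {φ : Sen (Δ p)} →
                  Γp p ⊢[ Δ p ] φ → Γp q ⊢[ Δ q ] tr (inclC (Δ⊆ p≤q)) φ
  ≤-preserves-⊢ {p} {q} p≤q ⊢φ =
    transitivity {Φ = img χ (Γp p)} Γq⊢χΓp (translation (inclC (Δ⊆ p≤q)) ⊢φ)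
    where
    χ : GMor (Δ p) (Δ q)
    χ = toG (inclC (Δ⊆ p≤q))

    Γq⊢χΓp : Γp q ⊢ₛ img χ (Γp p)
    Γq⊢χΓp _ (γ , γ∈Γp , refl) = monotonicity (Γ⊆ p≤q γ γ∈Γp)

  _∪¬_∣_ : (p : Cond) (φ : Sen (Δ p)) → ¬ (Γp p ⊢[ Δ p ] φ) → Cond
  p ∪¬ φ ∣ ⊬φ = record
    { Cp = Cp p ; uniq = uniq p ; Γp = Γp p ∪｛ ¬ₛ φ ｝ ; cons = ∪¬-consistent ⊬φ }

  ≤-∪¬ : (p : Cond) (φ : Sen (Δ p)) (⊬φ : ¬ (Γp p ⊢[ Δ p ] φ)) → p ≤ (p ∪¬ φ ∣ ⊬φ)
  ≤-∪¬ p φ ⊬φ =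
    record { Δ⊆ = λ c∈C → c∈C ; Γ⊆ = ⊆⇒Γ⊆ {Γ′ = Γp p ∪｛ ¬ₛ φ ｝} (λ _ → inj₁) }

  DenselyDerivable : (p : Cond) → Sen (Δ p) → Set₂
  DenselyDerivable p φ =
    (q : Cond) (p≤q : p ≤ q) → Σ[ r ∈ Cond ] Σ[ q≤r ∈ q ≤ r ] (Γp r ⊢[ Δ r ] lift p≤q q≤r φ)

  ⊢⇒denselyDerivable : (p : Cond) (φ : Sen (Δ p)) → Γp p ⊢[ Δ p ] φ → DenselyDerivable p φ
  ⊢⇒denselyDerivable p φ ⊢φ q p≤q = q , ≤-refl q , ≤-preserves-⊢ p≤q ⊢φ

  denselyDerivable⇒⊢ : ExcludedMiddle (lsuc (lsuc 0ℓ)) →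
                       (p : Cond) (φ : Sen (Δ p)) → DenselyDerivable p φ → Γp p ⊢[ Δ p ] φ
  denselyDerivable⇒⊢ em p φ dense with em {Γp p ⊢[ Δ p ] φ}
  ... | yes ⊢φ = ⊢φ
  ... | no ⊬φ with dense (p ∪¬ φ ∣ ⊬φ) (≤-∪¬ p φ ⊬φ)
  ...   | r , q≤r , ⊢φʳ = ⊥-elim (cons r (⊥-intro ⊢φʳ ⊢¬φʳ))
    where
    ⊢¬φʳ : Γp r ⊢[ Δ r ] (¬ₛ tr (inclC (Δ⊆ q≤r)) φ)
    ⊢¬φʳ = monotonicity (Γ⊆ q≤r (¬ₛ φ) (inj₂ refl))

lemmaD1 : (Sg : Sig) → AtMostCountable Sg → ExcludedMiddle (lsuc (lsuc 0ℓ)) →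
    let open Forcing Sg in
    (p : Cond) (φ : Sen (Δ p)) →
    (Γp p ⊢[ Δ p ] φ)
      ⇔ ((q : Cond) (pq : p ≤ q) → Σ[ r ∈ Cond ] Σ[ qr ∈ q ≤ r ] (Γp r ⊢[ Δ r ] lift pq qr φ))
lemmaD1 Sg _ em p φ = mk⇔ (⊢⇒denselyDerivable Sg p φ) (denselyDerivable⇒⊢ Sg em p φ)
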